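{- Let $k>4$ be an odd integer. Assume that, for every list $(e_0,e_1,\dots,e_{k-1})$ of $k$ elements, the last list passed to the callback by $\mathrm{Permutations}((e_0,\dots,e_{k-1}),0,\mathrm{Func})$ is $(e_1,e_0,e_2,e_3,\dots,e_{k-1})$. Consider the call $\mathrm{Permutations}(L,0,\mathrm{Func})$ with $L=(0,1,2,\dots,k)$ (a list of $k+1$ elements). Then each of the $k+1$ elements $0,1,\dots,k$ occupies position $0$ of $L$ at the start of exactly one of the $k+1$ recursive calls $\mathrm{Permutations}(L,1,\mathrm{Func})$ made directly by this top-level call, and the last list passed to the callback is $(1,4,3,5,6,7,8,\dots,k,2,0)$.
   Context: Lists are 0-indexed and mutable. $\mathrm{extract}(L,j)$ removes the element at position $j$ of $L$ and returns it; $\mathrm{Insert}(L,i,x)$ inserts $x$ into $L$ so that it occupies position $i$, shifting later elements one position to the right. The recursive procedure $\mathrm{Permutations}(L,i,\mathrm{Func})$ is: let $n$ be the length of $L$. If $i\ge n-1$, call $\mathrm{Func}(L)$. Otherwise: (1) call $\mathrm{Permutations}(L,i+1,\mathrm{Func})$; (2) do $\mathrm{Insert}(L,i,\mathrm{extract}(L,i+1))$ and call $\mathrm{Permutations}(L,i+1,\mathrm{Func})$; (3) repeat $\max(n-i-3,0)$ times: if $n-i$ is even do $\mathrm{Insert}(L,i,\mathrm{extract}(L,n-1))$, else do $\mathrm{Insert}(L,i,\mathrm{extract}(L,i+1))$, then call $\mathrm{Permutations}(L,i+1,\mathrm{Func})$; (4) if $n-i>2$, do $\mathrm{Insert}(L,i,\mathrm{extract}(L,i+1))$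 and call $\mathrm{Permutations}(L,i+1,\mathrm{Func})$. "Applying the algorithm" to a list means calling $\mathrm{Permutations}(L,0,\mathrm{Func})$; the lists passed to $\mathrm{Func}$ are the generated permutations, and the "last permutation" is the list passed to $\mathrm{Func}$ in its final invocation. -}

module Defs where

open import Data.Nat using (ℕ; zero; suc; _+_; _∸_; _≤?_; _<?_; _%_)
open import Data.Nat.Properties using (_≟_)
open import Data.List using (List; []; _∷_; _++_; length; filter; head; last; map)
open import Data.Maybe using (Maybe; just; nothing)
open import Data.Maybe.Properties using (≡-dec)
open import Data.Product using (_×_; _,_)
open import Relation.Nullary using (yes; no)
open import Relation.Nullary.Decidable using (⌊_⌋)

-- extract(L, j): remove element at position j, returning it and the rest
-- (nothing if j is out of range; never happens in the algorithm).
extract : {A : Set} → ℕ → List A → Maybe (A × List A)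
extract j [] = nothing
extract zero (x ∷ xs) = just (x , xs)
extract (suc j) (x ∷ xs) with extract j xs
... | nothing = nothing
... | just (y , ys) = just (y , x ∷ ys)

insertAt : {A : Set} → ℕ → A → List A → List A
insertAt zero x xs = x ∷ xs
insertAt (suc i) x [] = x ∷ []
insertAt (suc i) x (y ∷ ys) = y ∷ insertAt i x ys

move : {A : Set} → ℕ → ℕ → List A → List A
move i j L with extract j L
... | nothing = L
... | just (x , L') = insertAt i x L'

-- Result of a call Permutations(L, i, Func):
--   final state of L, lists passed to Func (in order),
--   and the states of L at the start of each direct recursive call.
record Result (A : Set) : Set where
  constructor result
  field
    final  : List A
    output : List (List A)
    starts : List (List A)
open Result public

-- fuel only guarantees termination; it is initialised to length L which
-- always exceeds the recursion depth.
permGo : {A : Set} → ℕ → ℕ → List A → Result A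
permGo fuel i L with suc i ≤? length L ∸ 1
permGo fuel i L | no _ = result L (L ∷ []) []
permGo zero i L | yes _ = result L (L ∷ []) []         -- unreachable
permGo {A} (suc f) i L | yes _ = step4 (loop (n ∸ i ∸ 3) (step2 (step1 L)))
  where
  n : ℕ
  n = length L
  -- state: current list, outputs so far, start lists so far
  St : Set
  St = List A × List (List A) × List (List A)
  call : List A → List (List A) → List (List A) → St
  call M os ss with permGo f (suc i) M
  ... | result M' os' _ = M' , os ++ os' , ss ++ (M ∷ [])
  step1 : List A → St
  step1 M = call M [] []
  step2 : St → St
  step2 (M , os , ss) = call (move i (suc i) M) os ss
  mv : List A → List A
  mv M with (n ∸ i) % 2 ≟ 0
  ... | yes _ = move i (n ∸ 1) M
  ... | no _ = move i (suc i) M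
  loop : ℕ → St → St
  loop zero s = s
  loop (suc r) (M , os , ss) = loop r (call (mv M) os ss)
  step4 : St → Result A
  step4 (M , os , ss) with 2 <? n ∸ i
  ... | yes _ with call (move i (suc i) M) os ss
  ...   | (M' , os' , ss') = result M' os' ss'
  step4 (M , os , ss) | no _ = result M os ss

permutations : {A : Set} → ℕ → List A → Result A
permutations i L = permGo (length L) i L

lastPerm : {A : Set} → List A → Maybe (List A)
lastPerm L = last (output (permutations 0 L))

swap01 : {A : Set} → List A → List A
swap01 (a ∷ b ∷ r) = b ∷ a ∷ r
swap01 L = L

countHead : ℕ → List (List ℕ) → ℕ
countHead x Ls = length (filter (λ M → ≡-dec _≟_ (head M) (just x)) Ls)

range : ℕ → List ℕ
range zero = []
range (suc m) = range m ++ (m ∷ [])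

{-# OPTIONS --safe #-}
-- With the element at position 0 held fixed, Permutations at level 1 behaves like
-- Permutations at level 0 on the tail, so by hypothesis every direct recursive call of
-- the top-level call turns its start list y ∷ M into y ∷ swap01 M. The first two calls
-- turn a0 ∷ a1 ∷ a2 ∷ D into a2 ∷ a1 ∷ a0 ∷ D. Since the list has even length k + 1,
-- step (3) moves the last element to the front, and as the following swap pins a1 at
-- position 1, each of the k − 2 rotations rotates the other elements right by one place,
-- bringing D back to the front. So the heads of the start lists are a0, a2, the elements
-- of D in reverse order and a1, and the final list is a1 ∷ swap01 (D ++ a2 ∷ a0 ∷ []).
-- This is also the last list passed to Func, as every call ends by passing its final list.
module Submission where

open import Defs
open import Data.Nat using (ℕ; zero; suc; _+_; _∸_; _<_; _≤_; _%_; _<?_; _≤?_; s≤s; z≤n)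
open import Data.Nat.Properties using (_≟_; +-suc; +-comm; +-identityʳ; suc-injective; ≤-pred; <-irrefl; ≤∧≢⇒<; n≤1+n; ≤-trans; ≤-refl)
open import Data.Nat.DivMod using (%-distribˡ-+)
open import Data.List using (List; []; _∷_; _++_; _ʳ++_; length; map; foldl; replicate; reverse; filter; head; last)
open import Data.List.Properties
  using (foldl-++; map-++; length-map; length-++; ++-assoc; ++-identityʳ; unfold-reverse; reverse-involutive; length-reverse; ʳ++-defn; filter-++; filter-accept; filter-reject)
open import Data.List.Relation.Binary.Pointwise using (Pointwise; []; _∷_; ++⁺; replicate⁺)
open import Data.List.Relation.Binary.Permutation.Propositional using (_↭_; ↭-sym; ↭-trans; ↭-reflexive; prep)
open import Data.List.Relation.Binary.Permutation.Propositional.Properties using (filter-↭; ↭-length; map⁺; ∷↭∷ʳ; ↭-reverse)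
open import Data.Maybe using (Maybe; just; nothing)
open import Data.Maybe.Properties using (just-injective; ≡-dec)
open import Data.Product using (_×_; _,_; proj₁; proj₂)
open import Data.Empty using (⊥-elim)
open import Function using (id; _∘_; case_of_)
open import Relation.Nullary using (Dec; yes; no; ¬_)
open import Relation.Binary.PropositionalEquality using (_≡_; _≢_; refl; sym; trans; cong; cong₂; subst; module ≡-Reasoning)

open ≡-Reasoning

last-++ : ∀ {B : Set} (xs : List B) {ys y} → last ys ≡ just y → last (xs ++ ys) ≡ just y
last-++ [] e = e
last-++ (x ∷ []) {[]} ()
last-++ (x ∷ []) {_ ∷ _} e = e
last-++ (x ∷ x′ ∷ xs) e = last-++ (x′ ∷ xs) e

module _ {A : Set} where

  leaf : List A → Result A
  leaf L = result L (L ∷ []) []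

  callStep : (List A → Result A) → Result A → (List A → List A) → Result A
  callStep rec R g =
    result (final (rec (g (final R)))) (output R ++ output (rec (g (final R)))) (starts R ++ g (final R) ∷ [])

  runCalls : (List A → Result A) → Result A → List (List A → List A) → Result A
  runCalls rec = foldl (callStep rec)

  rotateOrSwap : {P : Set} → Dec P → ℕ → ℕ → List A → List A
  rotateOrSwap (yes _) n i = move i (n ∸ 1)
  rotateOrSwap (no _)  n i = move i (suc i)

  closingSwap : {P : Set} → Dec P → ℕ → List (List A → List A)
  closingSwap (yes _) i = move i (suc i) ∷ []
  closingSwap (no _)  i = []

  -- The rearrangements of L made before each direct recursive call, following steps (1)–(4).
  levelMoves : ℕ → ℕ → List (List A → List A)
  levelMoves n i = id ∷ move i (suc i)
    ∷ replicate (n ∸ i ∸ 3) (rotateOrSwap ((n ∸ i) % 2 ≟ 0) n i) ++ closingSwap (2 <? n ∸ i) i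

  toResult : List A × List (List A) × List (List A) → Result A
  toResult (M , os , ss) = result M os ss

  -- The loop of step (3) is local to permGo and cannot be named, so it is characterised by its
  -- defining equations; the decision d of the first rotation is an argument so that the parity
  -- test can be abstracted by 'with' in permGo-unfold.
  module _ (rec : List A → Result A) (n i : ℕ) {P : Set} (D : Dec P) where
    loop≡runCalls : (lp : ℕ → Dec P → List A → List (List A) → List (List A) → List A × List (List A) × List (List A))
      → (∀ M os ss q → toResult (lp zero (yes q) M os ss) ≡ callStep rec (result M os ss) (move i (n ∸ 1)))
      → (∀ M os ss q → toResult (lp zero (no q) M os ss) ≡ callStep rec (result M os ss) (move i (suc i)))
      → (∀ r M os ss q → let R = callStep rec (result M os ss) (move i (n ∸ 1))
                          in lp (suc r) (yes q) M os ss ≡ lp r D (final R) (output R) (starts R))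
      → (∀ r M os ss q → let R = callStep rec (result M os ss) (move i (suc i))
                          in lp (suc r) (no q) M os ss ≡ lp r D (final R) (output R) (starts R))
      → ∀ r d M os ss → toResult (lp r d M os ss)
                        ≡ runCalls rec (callStep rec (result M os ss) (rotateOrSwap d n i)) (replicate r (rotateOrSwap D n i))
    loop≡runCalls lp base-yes base-no step-yes step-no = go
      where
      go : ∀ r d M os ss → toResult (lp r d M os ss)
                           ≡ runCalls rec (callStep rec (result M os ss) (rotateOrSwap d n i)) (replicate r (rotateOrSwap D n i))
      go zero    (yes q) M os ss = base-yes M os ss q
      go zero    (no q)  M os ss = base-no M os ss q
      go (suc r) (yes q) M os ss = trans (cong toResult (step-yes r M os ss q)) (go r D _ _ _)
      go (suc r) (no q)  M os ss = trans (cong toResult (step-no r M os ss q)) (go r D _ _ _)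

  permGo-unfold : ∀ f i (L : List A) → suc i ≤ length L ∸ 1 →
    permGo (suc f) i L ≡ runCalls (permGo f (suc i)) (result L [] []) (levelMoves (length L) i)
  permGo-unfold f i L p with suc i ≤? length L ∸ 1
  ... | no ¬p = ⊥-elim (¬p p)
  ... | yes _ with length L ∸ i ∸ 3
                 | final (runCalls (permGo f (suc i)) (result L [] []) (id ∷ move i (suc i) ∷ []))
                 | output (runCalls (permGo f (suc i)) (result L [] []) (id ∷ move i (suc i) ∷ []))
                 | starts (runCalls (permGo f (suc i)) (result L [] []) (id ∷ move i (suc i) ∷ []))
                 | 2 <? length L ∸ i
                 | loop≡runCalls (permGo f (suc i)) (length L) i ((length L ∸ i) % 2 ≟ 0) _
                     (λ _ _ _ _ → refl) (λ _ _ _ _ → refl) (λ _ _ _ _ _ → refl) (λ _ _ _ _ _ → refl)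
  ... | zero  | M | os | ss | yes _ | _ = refl
  ... | zero  | M | os | ss | no _  | _ = refl
  ... | suc r | M | os | ss | yes q | loop≡ with (length L ∸ i) % 2 ≟ 0
  ...   | d = trans (cong (λ R → runCalls (permGo f (suc i)) R (closingSwap (yes q) i)) (loop≡ r d M os ss))
                (sym (foldl-++ (callStep (permGo f (suc i))) (result M os ss)
                               (replicate (suc r) (rotateOrSwap d (length L) i)) (closingSwap (yes q) i)))
  permGo-unfold f i L p | yes _ | suc r | M | os | ss | no q | loop≡ with (length L ∸ i) % 2 ≟ 0
  ...   | d = trans (loop≡ r d M os ss)
                (sym (foldl-++ (callStep (permGo f (suc i))) (result M os ss)
                               (replicate (suc r) (rotateOrSwap d (length L) i)) (closingSwap (no q) i)))

  permGo-leaf : ∀ f i (L : List A) → ¬ (suc i ≤ length L ∸ 1) → permGo f i L ≡ leaf L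
  permGo-leaf f i L ¬p with suc i ≤? length L ∸ 1
  ... | yes p = ⊥-elim (¬p p)
  ... | no _  = refl

  permGo-zero : ∀ i (L : List A) → permGo zero i L ≡ leaf L
  permGo-zero i L with suc i ≤? length L ∸ 1
  ... | yes _ = refl
  ... | no _  = refl

  LastOutputIsFinal : Result A → Set
  LastOutputIsFinal R = last (output R) ≡ just (final R)

  runCalls-lastOutput : ∀ rec → (∀ M → LastOutputIsFinal (rec M)) →
    ∀ R gs → gs ≢ [] → LastOutputIsFinal (runCalls rec R gs)
  runCalls-lastOutput rec rec-last R []            []≢[] = ⊥-elim ([]≢[] refl)
  runCalls-lastOutput rec rec-last R (g ∷ [])      _     = last-++ (output R) (rec-last (g (final R)))
  runCalls-lastOutput rec rec-last R (g ∷ g′ ∷ gs) _     =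
    runCalls-lastOutput rec rec-last (callStep rec R g) (g′ ∷ gs) λ ()

  permGo-lastOutput : ∀ f i (L : List A) → LastOutputIsFinal (permGo f i L)
  permGo-lastOutput zero i L = subst LastOutputIsFinal (sym (permGo-zero i L)) refl
  permGo-lastOutput (suc f) i L = case suc i ≤? length L ∸ 1 of λ where
    (no ¬p) → subst LastOutputIsFinal (sym (permGo-leaf (suc f) i L ¬p)) refl
    (yes p) → subst LastOutputIsFinal (sym (permGo-unfold f i L p))
                (runCalls-lastOutput (permGo f (suc i)) (permGo-lastOutput f (suc i)) (result L [] []) (levelMoves (length L) i) λ ())

  mapResult : A → Result A → Result A
  mapResult x R = result (x ∷ final R) (map (x ∷_) (output R)) (map (x ∷_) (starts R))

  ShiftOf : (List A → List A) → (List A → List A) → Set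
  ShiftOf g′ g = ∀ x M → g′ (x ∷ M) ≡ x ∷ g M

  move-cons : ∀ i j → ShiftOf (move (suc i) (suc j)) (move i j)
  move-cons i j x M with extract j M
  ... | nothing = refl
  ... | just _  = refl

  levelMoves-cons : ∀ m i → Pointwise ShiftOf (levelMoves (suc (suc m)) (suc i)) (levelMoves (suc m) i)
  levelMoves-cons m i =
    (λ _ _ → refl) ∷ move-cons i (suc i)
      ∷ ++⁺ (replicate⁺ (rotateOrSwap-cons ((suc m ∸ i) % 2 ≟ 0)) (suc m ∸ i ∸ 3)) (closingSwap-cons (2 <? suc m ∸ i))
    where
    rotateOrSwap-cons : {P : Set} (d : Dec P) → ShiftOf (rotateOrSwap d (suc (suc m)) (suc i)) (rotateOrSwap d (suc m) i)
    rotateOrSwap-cons (yes _) = move-cons i m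
    rotateOrSwap-cons (no _)  = move-cons i (suc i)
    closingSwap-cons : {P : Set} (d : Dec P) → Pointwise ShiftOf (closingSwap d (suc i)) (closingSwap d i)
    closingSwap-cons (yes _) = move-cons i (suc i) ∷ []
    closingSwap-cons (no _)  = []

  module _ {rec′ rec : List A → Result A} {x : A} (rec-cons : ∀ M → rec′ (x ∷ M) ≡ mapResult x (rec M)) where
    callStep-cons : ∀ R {g′ g} → ShiftOf g′ g → callStep rec′ (mapResult x R) g′ ≡ mapResult x (callStep rec R g)
    callStep-cons R {g′} {g} g′≈g
      rewrite g′≈g x (final R) | rec-cons (g (final R)) =
        cong₂ (result _) (sym (map-++ (x ∷_) (output R) _)) (sym (map-++ (x ∷_) (starts R) _))

    runCalls-cons : ∀ R {gs′ gs} → Pointwise ShiftOf gs′ gs → runCalls rec′ (mapResult x R) gs′ ≡ mapResult x (runCalls rec R gs)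
    runCalls-cons R [] = refl
    runCalls-cons R {g′ ∷ gs′} {g ∷ gs} (g′≈g ∷ gs′≈gs) =
      trans (cong (λ R′ → runCalls rec′ R′ gs′) (callStep-cons R {g′} {g} g′≈g)) (runCalls-cons _ gs′≈gs)

  permGo-cons : ∀ f i x (L : List A) → permGo f (suc i) (x ∷ L) ≡ mapResult x (permGo f i L)
  permGo-cons zero i x L = trans (permGo-zero (suc i) (x ∷ L)) (cong (mapResult x) (sym (permGo-zero i L)))
  permGo-cons (suc f) i x [] =
    trans (permGo-leaf (suc f) (suc i) (x ∷ []) λ ()) (cong (mapResult x) (sym (permGo-leaf (suc f) i [] λ ())))
  permGo-cons (suc f) i x (y ∷ L) = case suc i ≤? length L of λ where
    (no ¬p) → trans (permGo-leaf (suc f) (suc i) (x ∷ y ∷ L) (¬p ∘ ≤-pred))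
                    (cong (mapResult x) (sym (permGo-leaf (suc f) i (y ∷ L) ¬p)))
    (yes p) → begin
      permGo (suc f) (suc i) (x ∷ y ∷ L)
        ≡⟨ permGo-unfold f (suc i) (x ∷ y ∷ L) (s≤s p) ⟩
      runCalls (permGo f (suc (suc i))) (mapResult x (result (y ∷ L) [] [])) (levelMoves (length (x ∷ y ∷ L)) (suc i))
        ≡⟨ runCalls-cons {rec′ = permGo f (suc (suc i))} {rec = permGo f (suc i)}
                         (permGo-cons f (suc i) x) (result (y ∷ L) [] []) (levelMoves-cons (length L) i) ⟩
      mapResult x (runCalls (permGo f (suc i)) (result (y ∷ L) [] []) (levelMoves (length (y ∷ L)) i))
        ≡⟨ cong (mapResult x) (permGo-unfold f i (y ∷ L) p) ⟨
      mapResult x (permGo (suc f) i (y ∷ L)) ∎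

  SwapsAfterHead : ℕ → (List A → Result A) → Set
  SwapsAfterHead k rec = ∀ y M → length M ≡ k → final (rec (y ∷ M)) ≡ y ∷ swap01 M

  permGo-swapsAfterHead : ∀ k → (∀ M → length M ≡ k → lastPerm M ≡ just (swap01 M)) → SwapsAfterHead k (permGo k 1)
  permGo-swapsAfterHead k lastPerm≡ y M refl = begin
    final (permGo (length M) 1 (y ∷ M))  ≡⟨ cong final (permGo-cons (length M) 0 y M) ⟩
    y ∷ final (permutations 0 M)         ≡⟨ cong (y ∷_) (just-injective (trans (sym (permGo-lastOutput (length M) 0 M)) (lastPerm≡ M refl))) ⟩
    y ∷ swap01 M                         ∎

  extract-last : ∀ (P : List A) b → extract (length P) (P ++ b ∷ []) ≡ just (b , P)
  extract-last []      b = refl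
  extract-last (x ∷ P) b rewrite extract-last P b = refl

  move-to-front : ∀ (P : List A) b → move 0 (length P) (P ++ b ∷ []) ≡ b ∷ P
  move-to-front P b rewrite extract-last P b = refl

  summary : Result A → List A × List (Maybe A)
  summary R = final R , map head (starts R)

  module Rotations {k : ℕ} {rec : List A → Result A} (swaps : SwapsAfterHead k rec) where
    callStep-summary : ∀ R g {M hs y N} → summary R ≡ (M , hs) → g M ≡ y ∷ N → length N ≡ k →
      summary (callStep rec R g) ≡ (y ∷ swap01 N , hs ++ just y ∷ [])
    callStep-summary R g {y = y} {N} refl gM≡ |N|≡k = begin
      (final (rec (g (final R))) , map head (starts R ++ g (final R) ∷ []))
        ≡⟨ cong (λ X → final (rec X) , map head (starts R ++ X ∷ [])) gM≡ ⟩
      (final (rec (y ∷ N)) , map head (starts R ++ (y ∷ N) ∷ []))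
        ≡⟨ cong₂ _,_ (swaps y N |N|≡k) (map-++ head (starts R) _) ⟩
      (y ∷ swap01 N , map head (starts R) ++ just y ∷ []) ∎

    -- With a fixed at position 1, each call rotates the rest of the list right by one place.
    rotations : ∀ V c a T R hs → length (c ∷ a ∷ T ++ reverse V) ≡ suc k → summary R ≡ (c ∷ a ∷ T ++ reverse V , hs) →
      summary (runCalls rec R (replicate (length V) (move 0 k))) ≡ (insertAt 1 a (V ʳ++ c ∷ T) , hs ++ map just V)
    rotations [] c a T R hs _ R≡ = trans R≡ (cong₂ _,_ (cong (λ X → c ∷ a ∷ X) (++-identityʳ T)) (sym (++-identityʳ hs)))
    rotations (b ∷ V) c a T R hs |M|≡ R≡ = begin
      summary (runCalls rec (callStep rec R (move 0 k)) (replicate (length V) (move 0 k)))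
        ≡⟨ rotations V b a (c ∷ T) _ _ (cong suc |P|≡k) (callStep-summary R (move 0 k) R≡ moved |P|≡k) ⟩
      (insertAt 1 a (V ʳ++ b ∷ c ∷ T) , (hs ++ just b ∷ []) ++ map just V)
        ≡⟨ cong (_ ,_) (++-assoc hs _ _) ⟩
      (insertAt 1 a ((b ∷ V) ʳ++ c ∷ T) , hs ++ map just (b ∷ V)) ∎
      where
      P : List A
      P = c ∷ a ∷ T ++ reverse V
      M≡ : c ∷ a ∷ T ++ reverse (b ∷ V) ≡ P ++ b ∷ []
      M≡ = cong (λ X → c ∷ a ∷ X) (trans (cong (T ++_) (unfold-reverse b V)) (sym (++-assoc T (reverse V) _)))
      |P|≡k : length P ≡ k
      |P|≡k = suc-injective (begin
        suc (length P)          ≡⟨ +-comm 1 (length P) ⟩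
        length P + 1            ≡⟨ length-++ P ⟨
        length (P ++ b ∷ [])    ≡⟨ cong length M≡ ⟨
        length (c ∷ a ∷ T ++ reverse (b ∷ V)) ≡⟨ |M|≡ ⟩
        suc k                   ∎)
      moved : move 0 k (c ∷ a ∷ T ++ reverse (b ∷ V)) ≡ b ∷ P
      moved = trans (cong (move 0 k) M≡) (subst (λ j → move 0 j (P ++ b ∷ []) ≡ b ∷ P) |P|≡k (move-to-front P b))

  levelZero-summary : ∀ {k rec} → SwapsAfterHead k rec → suc k % 2 ≡ 0 → ∀ a0 a1 a2 d E → length (a1 ∷ a2 ∷ d ∷ E) ≡ k →
    summary (runCalls rec (result (a0 ∷ a1 ∷ a2 ∷ d ∷ E) [] []) (levelMoves (suc k) 0))
      ≡ (a1 ∷ swap01 (d ∷ E ++ a2 ∷ a0 ∷ []) , map just (a0 ∷ a2 ∷ reverse (d ∷ E) ++ a1 ∷ []))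
  levelZero-summary {rec = rec} swaps even a0 a1 a2 d E refl with suc (suc (suc (suc (length E)))) % 2 ≟ 0
  ... | no odd = ⊥-elim (odd even)
  ... | yes _ = begin
    summary (runCalls rec R₂ (rotate ++ move 0 1 ∷ []))
      ≡⟨ cong summary (foldl-++ (callStep rec) R₂ rotate (move 0 1 ∷ [])) ⟩
    summary (callStep rec (runCalls rec R₂ rotate) (move 0 1))
      ≡⟨ callStep-summary (runCalls rec R₂ rotate) (move 0 1) rotated refl |N|≡k ⟩
    (a1 ∷ swap01 (d ∷ E ++ a2 ∷ a0 ∷ []) , just a0 ∷ just a2 ∷ map just (reverse D) ++ just a1 ∷ [])
      ≡⟨ cong (λ hs → a1 ∷ swap01 (d ∷ E ++ a2 ∷ a0 ∷ []) , just a0 ∷ just a2 ∷ hs) (map-++ just (reverse D) (a1 ∷ [])) ⟨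
    (a1 ∷ swap01 (d ∷ E ++ a2 ∷ a0 ∷ []) , map just (a0 ∷ a2 ∷ reverse D ++ a1 ∷ [])) ∎
    where
    open Rotations {rec = rec} swaps
    D : List A
    D = d ∷ E
    k : ℕ
    k = length (a1 ∷ a2 ∷ D)
    rotate : List (List A → List A)
    rotate = replicate (suc (length E)) (move 0 k)
    R₁ R₂ : Result A
    R₁ = callStep rec (result (a0 ∷ a1 ∷ a2 ∷ D) [] []) id
    R₂ = callStep rec R₁ (move 0 1)
    R₂≡ : summary R₂ ≡ (a2 ∷ a1 ∷ (a0 ∷ []) ++ reverse (reverse D) , just a0 ∷ just a2 ∷ [])
    R₂≡ = trans (callStep-summary R₁ (move 0 1) (callStep-summary (result (a0 ∷ a1 ∷ a2 ∷ D) [] []) id refl refl refl) refl refl)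
                (cong (λ X → a2 ∷ a1 ∷ a0 ∷ X , just a0 ∷ just a2 ∷ []) (sym (reverse-involutive D)))
    rotated : summary (runCalls rec R₂ rotate) ≡ (d ∷ a1 ∷ E ++ a2 ∷ a0 ∷ [] , just a0 ∷ just a2 ∷ map just (reverse D))
    rotated = begin
      summary (runCalls rec R₂ rotate)
        ≡⟨ cong (λ r → summary (runCalls rec R₂ (replicate r (move 0 k)))) (length-reverse D) ⟨
      summary (runCalls rec R₂ (replicate (length (reverse D)) (move 0 k)))
        ≡⟨ rotations (reverse D) a2 a1 (a0 ∷ []) R₂ _ (cong (λ X → 3 + length X) (reverse-involutive D)) R₂≡ ⟩
      (insertAt 1 a1 (reverse D ʳ++ a2 ∷ a0 ∷ []) , just a0 ∷ just a2 ∷ map just (reverse D))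
        ≡⟨ cong (λ X → insertAt 1 a1 X , just a0 ∷ just a2 ∷ map just (reverse D)) (trans (ʳ++-defn (reverse D)) (cong (_++ _) (reverse-involutive D))) ⟩
      (d ∷ a1 ∷ E ++ a2 ∷ a0 ∷ [] , just a0 ∷ just a2 ∷ map just (reverse D)) ∎
    |N|≡k : length (d ∷ E ++ a2 ∷ a0 ∷ []) ≡ k
    |N|≡k = cong suc (trans (length-++ E) (+-comm (length E) 2))

  permutations-levelZero : ∀ {k} → (∀ (M : List A) → length M ≡ k → lastPerm M ≡ just (swap01 M)) → suc k % 2 ≡ 0 →
    ∀ (a0 a1 a2 d : A) E → length (a1 ∷ a2 ∷ d ∷ E) ≡ k →
    let R = permutations 0 (a0 ∷ a1 ∷ a2 ∷ d ∷ E)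
    in final R ≡ a1 ∷ swap01 (d ∷ E ++ a2 ∷ a0 ∷ []) × map head (starts R) ↭ map just (a0 ∷ a1 ∷ a2 ∷ d ∷ E)
  permutations-levelZero {k} lastPerm≡ even a0 a1 a2 d E refl =
    cong proj₁ summary≡ , ↭-trans (↭-reflexive (cong proj₂ summary≡)) (map⁺ just heads↭)
    where
    summary≡ : summary (permutations 0 (a0 ∷ a1 ∷ a2 ∷ d ∷ E))
               ≡ (a1 ∷ swap01 (d ∷ E ++ a2 ∷ a0 ∷ []) , map just (a0 ∷ a2 ∷ reverse (d ∷ E) ++ a1 ∷ []))
    summary≡ = trans (cong summary (permGo-unfold k 0 (a0 ∷ a1 ∷ a2 ∷ d ∷ E) (s≤s z≤n)))
                     (levelZero-summary {rec = permGo k 1} (permGo-swapsAfterHead k lastPerm≡) even a0 a1 a2 d E refl)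
    heads↭ : a0 ∷ a2 ∷ reverse (d ∷ E) ++ a1 ∷ [] ↭ a0 ∷ a1 ∷ a2 ∷ d ∷ E
    heads↭ = prep a0 (↭-trans (↭-sym (∷↭∷ʳ a1 (a2 ∷ reverse (d ∷ E)))) (prep a1 (prep a2 (↭-reverse (d ∷ E)))))

countJust : ℕ → List (Maybe ℕ) → ℕ
countJust x = length ∘ filter (λ m → ≡-dec _≟_ m (just x))

countHead≡countJust : ∀ x Ls → countHead x Ls ≡ countJust x (map head Ls)
countHead≡countJust x [] = refl
countHead≡countJust x (M ∷ Ls) with ≡-dec _≟_ (head M) (just x)
... | yes _ = cong suc (countHead≡countJust x Ls)
... | no _  = countHead≡countJust x Ls

countJust-++ : ∀ x ms ns → countJust x (ms ++ ns) ≡ countJust x ms + countJust x ns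
countJust-++ x ms ns = trans (cong length (filter-++ _ ms ns)) (length-++ (filter _ ms))

countJust-hit : ∀ x → countJust x (just x ∷ []) ≡ 1
countJust-hit x = cong length (filter-accept (λ m → ≡-dec _≟_ m (just x)) refl)

countJust-miss : ∀ {x n} → n ≢ x → countJust x (just n ∷ []) ≡ 0
countJust-miss {x} n≢x = cong length (filter-reject (λ m → ≡-dec _≟_ m (just x)) (n≢x ∘ just-injective))

countJust-range-snoc : ∀ x n → countJust x (map just (range (suc n))) ≡ countJust x (map just (range n)) + countJust x (just n ∷ [])
countJust-range-snoc x n = trans (cong (countJust x) (map-++ just (range n) (n ∷ []))) (countJust-++ x (map just (range n)) _)

countJust-range-absent : ∀ x n → n ≤ x → countJust x (map just (range n)) ≡ 0
countJust-range-absent x zero    _   = refl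
countJust-range-absent x (suc n) n<x = trans (countJust-range-snoc x n)
  (cong₂ _+_ (countJust-range-absent x n (≤-trans (n≤1+n n) n<x)) (countJust-miss (λ n≡x → <-irrefl n≡x n<x)))

countJust-range : ∀ x n → x < n → countJust x (map just (range n)) ≡ 1
countJust-range x (suc n) x<1+n with x ≟ n
... | yes refl = trans (countJust-range-snoc x x) (cong₂ _+_ (countJust-range-absent x x ≤-refl) (countJust-hit x))
... | no x≢n   = trans (countJust-range-snoc x n)
  (cong₂ _+_ (countJust-range x n (≤∧≢⇒< (≤-pred x<1+n) x≢n)) (countJust-miss (x≢n ∘ sym)))

length-range : ∀ n → length (range n) ≡ n
length-range zero    = refl
length-range (suc n) = trans (length-++ (range n)) (trans (cong (_+ 1) (length-range n)) (+-comm n 1))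

range-+ : ∀ m n → range (m + n) ≡ range m ++ map (m +_) (range n)
range-+ m zero    = trans (cong range (+-identityʳ m)) (sym (++-identityʳ (range m)))
range-+ m (suc n) = begin
  range (m + suc n)                                   ≡⟨ cong range (+-suc m n) ⟩
  range (m + n) ++ m + n ∷ []                         ≡⟨ cong (_++ m + n ∷ []) (range-+ m n) ⟩
  (range m ++ map (m +_) (range n)) ++ m + n ∷ []     ≡⟨ ++-assoc (range m) _ _ ⟩
  range m ++ map (m +_) (range n) ++ m + n ∷ []       ≡⟨ cong (range m ++_) (map-++ (m +_) (range n) (n ∷ [])) ⟨
  range m ++ map (m +_) (range (suc n))               ∎

heads↭range⇒eachHeadOnce : ∀ {Ls n} → map head Ls ↭ map just (range n) → length Ls ≡ n × (∀ x → x < n → countHead x Ls ≡ 1)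
heads↭range⇒eachHeadOnce {Ls} {n} heads↭ = |Ls|≡n , once
  where
  |Ls|≡n : length Ls ≡ n
  |Ls|≡n = begin
    length Ls                   ≡⟨ length-map head Ls ⟨
    length (map head Ls)        ≡⟨ ↭-length heads↭ ⟩
    length (map just (range n)) ≡⟨ length-map just (range n) ⟩
    length (range n)            ≡⟨ length-range n ⟩
    n                           ∎
  once : ∀ x → x < n → countHead x Ls ≡ 1
  once x x<n = begin
    countHead x Ls                   ≡⟨ countHead≡countJust x Ls ⟩
    countJust x (map head Ls)        ≡⟨ ↭-length (filter-↭ (λ m → ≡-dec _≟_ m (just x)) heads↭) ⟩
    countJust x (map just (range n)) ≡⟨ countJust-range x n x<n ⟩
    1                                ∎

lemma1 : (k : ℕ) → 4 < k → k % 2 ≡ 1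
    → ((e : List ℕ) → length e ≡ k → lastPerm e ≡ just (swap01 e))
    → (length (starts (permutations 0 (range (suc k)))) ≡ suc k
       × ((x : ℕ) → x ≤ k → countHead x (starts (permutations 0 (range (suc k)))) ≡ 1))
      × lastPerm (range (suc k)) ≡ just (1 ∷ 4 ∷ 3 ∷ map (5 +_) (range (k ∸ 4)) ++ 2 ∷ 0 ∷ [])
lemma1 k@(suc (suc (suc (suc (suc m))))) (s≤s (s≤s (s≤s (s≤s (s≤s _))))) k-odd lastPerm≡ =
  (|starts|≡ , λ x x≤k → once x (s≤s x≤k)) , trans (permGo-lastOutput (length L) 0 L) (cong just final≡)
  where
  Q L : List ℕ
  Q = map (5 +_) (range (suc m))
  L = range (suc k)
  L≡ : L ≡ 0 ∷ 1 ∷ 2 ∷ 3 ∷ 4 ∷ Q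
  L≡ = range-+ 5 (suc m)
  |k+1|-even : suc k % 2 ≡ 0
  |k+1|-even = trans (%-distribˡ-+ 1 k 2) (cong (λ r → (1 + r) % 2) k-odd)
  top : final (permutations 0 (0 ∷ 1 ∷ 2 ∷ 3 ∷ 4 ∷ Q)) ≡ 1 ∷ 4 ∷ 3 ∷ Q ++ 2 ∷ 0 ∷ []
        × map head (starts (permutations 0 (0 ∷ 1 ∷ 2 ∷ 3 ∷ 4 ∷ Q))) ↭ map just (0 ∷ 1 ∷ 2 ∷ 3 ∷ 4 ∷ Q)
  top = permutations-levelZero lastPerm≡ |k+1|-even 0 1 2 3 (4 ∷ Q)
          (cong (4 +_) (trans (length-map (5 +_) (range (suc m))) (length-range (suc m))))
  final≡ : final (permutations 0 L) ≡ 1 ∷ 4 ∷ 3 ∷ Q ++ 2 ∷ 0 ∷ []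
  final≡ = trans (cong (final ∘ permutations 0) L≡) (proj₁ top)
  heads↭ : map head (starts (permutations 0 L)) ↭ map just L
  heads↭ = subst (λ L′ → map head (starts (permutations 0 L′)) ↭ map just L′) (sym L≡) (proj₂ top)
  |starts|≡ : length (starts (permutations 0 L)) ≡ suc k
  |starts|≡ = proj₁ (heads↭range⇒eachHeadOnce heads↭)
  once : ∀ x → x < suc k → countHead x (starts (permutations 0 L)) ≡ 1
  once = proj₂ (heads↭range⇒eachHeadOnce heads↭)
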